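{- Let $G$ be the multigraph on vertex set $\{1,2,3,4\}$ with nine edges colored red, blue and green as follows: red edges $13, 34, 42$ (forming the path $1\!-\!3\!-\!4\!-\!2$); blue edges $12, 23, 34$ (forming the path $1\!-\!2\!-\!3\!-\!4$); green edges $14, 43, 32$ (forming the path $1\!-\!4\!-\!3\!-\!2$). Then each color class is a spanning path, but $G$ does not contain any collection of $3$ pairwise edge-disjoint rainbow spanning paths.
   Context: Parallel edges are distinct edges (here distinguished by color). A spanning path on a set of $n$ vertices is a set of $n-1$ edges that includes every vertex and in which every vertex has degree at most $2$ (a Hamiltonian path). A subgraph is rainbow if all its edges have distinct colors. -}

module Defs where

open import Data.Nat using (ℕ; suc; _≤_)
open import Data.Fin using (Fin; zero; suc; _≟_)
open import Data.Fin.Subset using (Subset; _∈_; ∣_∣)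
open import Data.Fin.Subset.Properties using (_∈?_)
open import Data.Product using (_×_; ∃; _,_; proj₁; proj₂)
open import Data.Vec using (Vec; tabulate; lookup; []; _∷_)
import Data.Empty
open import Data.List using (List; filter; length; allFin)
open import Relation.Binary.PropositionalEquality using (_≡_; _≢_)
open import Relation.Nullary using (Dec; yes; no; ¬_)
open import Relation.Nullary.Decidable using (_⊎-dec_; _×-dec_; ⌊_⌋)
open import Data.Sum using (_⊎_)

-- A finite multigraph with n vertices Fin n and m edges Fin m; each edge has two
-- endpoints and a colour. Parallel edges are distinct edges (different indices).
record ColouredMultigraph (n m k : ℕ) : Set where
  field
    end₁ end₂ : Fin m → Fin n
    colour    : Fin m → Fin k
open ColouredMultigraph public

Incident : ∀ {n m k} → ColouredMultigraph n m k → Fin n → Fin m → Set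
Incident G v e = (end₁ G e ≡ v) ⊎ (end₂ G e ≡ v)

incident? : ∀ {n m k} (G : ColouredMultigraph n m k) v e → Dec (Incident G v e)
incident? G v e = (end₁ G e ≟ v) ⊎-dec (end₂ G e ≟ v)

-- degree of v in the edge set S (a loop would count once; there are none here)
degree : ∀ {n m k} → ColouredMultigraph n m k → Subset m → Fin n → ℕ
degree G S v = length (filter (λ e → (e ∈? S) ×-dec incident? G v e) (allFin _))

SpanningPath : ∀ {n m k} → ColouredMultigraph (suc n) m k → Subset m → Set
SpanningPath {n} G S =
  (∣ S ∣ ≡ n) ×
  (∀ v → ∃ λ e → e ∈ S × Incident G v e) ×
  (∀ v → degree G S v ≤ 2)

Rainbow : ∀ {n m k} → ColouredMultigraph n m k → Subset m → Set
Rainbow G S = ∀ e f → e ∈ S → f ∈ S → colour G e ≡ colour G f → e ≡ f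

colourClass : ∀ {n m k} → ColouredMultigraph n m k → Fin k → Subset m
colourClass G c = tabulate (λ e → ⌊ colour G e ≟ c ⌋)

Disjoint : ∀ {m} → Subset m → Subset m → Set
Disjoint S T = ∀ e → e ∈ S → e ∈ T → Data.Empty.⊥

v1 v2 v3 v4 : Fin 4
v1 = zero
v2 = suc zero
v3 = suc (suc zero)
v4 = suc (suc (suc zero))

red blue green : Fin 3
red = zero
blue = suc zero
green = suc (suc zero)

edgeData : Vec (Fin 4 × Fin 4 × Fin 3) 9
edgeData =
  (v1 , v3 , red) ∷ (v3 , v4 , red) ∷ (v4 , v2 , red) ∷
  (v1 , v2 , blue) ∷ (v2 , v3 , blue) ∷ (v3 , v4 , blue) ∷
  (v1 , v4 , green) ∷ (v4 , v3 , green) ∷ (v3 , v2 , green) ∷ []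

G : ColouredMultigraph 4 9 3
G = record
  { end₁ = λ e → proj₁ (lookup edgeData e)
  ; end₂ = λ e → proj₁ (proj₂ (lookup edgeData e))
  ; colour = λ e → proj₂ (proj₂ (lookup edgeData e))
  }

-- Three pairwise edge-disjoint rainbow spanning paths have 3 + 3 + 3 = 9 edges,
-- so they would use every edge of G. But the blue edge 34 lies on no rainbow
-- spanning path: its red and green companions always either repeat the pair 34,
-- close a cycle through 3 and 4, or give 3 or 4 a third edge.
module Submission where

open import Defs
open import Data.Empty using (⊥-elim)
open import Data.Fin as Fin using (Fin; zero; #_; _≟_)
open import Data.Fin.Properties using (all?; any?)
open import Data.Fin.Subset using (Subset; inside; outside; _∉_; _∪_; ∣_∣)
open import Data.Fin.Subset.Properties using (_∈?_; anySubset?; ∣p∣≤n; x∈p∪q⁻)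
open import Data.Nat using (suc; _+_; _<_; _≤?_; s≤s)
open import Data.Nat.Properties using (+-suc; <-irrefl; m≤n⇒m≤1+n)
open import Data.Product using (_×_; Σ; _,_; proj₁)
open import Data.Sum using ([_,_])
open import Data.Vec using (_∷_; []; here; there)
open import Relation.Binary.PropositionalEquality using (_≡_; refl; sym; trans; cong; cong₂; subst)
open import Relation.Nullary using (¬_)
open import Relation.Nullary.Decidable using (_×-dec_; _→-dec_; from-yes; from-no)
open import Relation.Unary using (Decidable)

spanningPath? : ∀ {n m k} (H : ColouredMultigraph (suc n) m k) → Decidable (SpanningPath H)
spanningPath? {n} H S =
  (∣ S ∣ Data.Nat.≟ n)
  ×-dec all? (λ v → any? (λ e → (e ∈? S) ×-dec incident? H v e))
  ×-dec all? (λ v → degree H S v ≤? 2)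

rainbow? : ∀ {n m k} (H : ColouredMultigraph n m k) → Decidable (Rainbow H)
rainbow? H S = all? λ e → all? λ f →
  (e ∈? S) →-dec (f ∈? S) →-dec (colour H e ≟ colour H f) →-dec (e ≟ f)

disjoint-∷⁻ : ∀ {m s t} {p q : Subset m} → Disjoint (s ∷ p) (t ∷ q) → Disjoint p q
disjoint-∷⁻ d e e∈p e∈q = d (Fin.suc e) (there e∈p) (there e∈q)

disjoint-∪ʳ : ∀ {m} {p q r : Subset m} → Disjoint p q → Disjoint p r → Disjoint p (q ∪ r)
disjoint-∪ʳ {q = q} {r} d₁ d₂ e e∈p e∈q∪r =
  [ d₁ e e∈p , d₂ e e∈p ] (x∈p∪q⁻ q r e∈q∪r)

x∉p∪q : ∀ {m} {x : Fin m} {p q : Subset m} → x ∉ p → x ∉ q → x ∉ p ∪ q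
x∉p∪q {p = p} {q} x∉p x∉q x∈p∪q = [ x∉p , x∉q ] (x∈p∪q⁻ p q x∈p∪q)

∣p∪q∣≡∣p∣+∣q∣ : ∀ {m} {p q : Subset m} → Disjoint p q → ∣ p ∪ q ∣ ≡ ∣ p ∣ + ∣ q ∣
∣p∪q∣≡∣p∣+∣q∣ {p = []}          {[]}          _ = refl
∣p∪q∣≡∣p∣+∣q∣ {p = inside  ∷ _} {inside  ∷ _} d = ⊥-elim (d _ here here)
∣p∪q∣≡∣p∣+∣q∣ {p = inside  ∷ _} {outside ∷ _} d = cong suc (∣p∪q∣≡∣p∣+∣q∣ (disjoint-∷⁻ d))
∣p∪q∣≡∣p∣+∣q∣ {p = outside ∷ p} {inside  ∷ q} d =
  trans (cong suc (∣p∪q∣≡∣p∣+∣q∣ (disjoint-∷⁻ d))) (sym (+-suc ∣ p ∣ ∣ q ∣))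
∣p∪q∣≡∣p∣+∣q∣ {p = outside ∷ _} {outside ∷ _} d = ∣p∪q∣≡∣p∣+∣q∣ (disjoint-∷⁻ d)

x∉p⇒∣p∣<n : ∀ {n} {x : Fin n} {p : Subset n} → x ∉ p → ∣ p ∣ < n
x∉p⇒∣p∣<n {x = zero}      {inside  ∷ _} x∉p = ⊥-elim (x∉p here)
x∉p⇒∣p∣<n {x = zero}      {outside ∷ p} _   = s≤s (∣p∣≤n p)
x∉p⇒∣p∣<n {x = Fin.suc _} {inside  ∷ _} x∉p = s≤s (x∉p⇒∣p∣<n (λ x∈p → x∉p (there x∈p)))
x∉p⇒∣p∣<n {x = Fin.suc _} {outside ∷ _} x∉p = m≤n⇒m≤1+n (x∉p⇒∣p∣<n (λ x∈p → x∉p (there x∈p)))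

pairwiseDisjoint-avoiding-∣∣ : ∀ {m} {x : Fin m} {p q r : Subset m} →
  Disjoint p q → Disjoint p r → Disjoint q r → x ∉ p → x ∉ q → x ∉ r →
  ∣ p ∣ + (∣ q ∣ + ∣ r ∣) < m
pairwiseDisjoint-avoiding-∣∣ {p = p} {q} {r} d₁₂ d₁₃ d₂₃ x∉p x∉q x∉r =
  subst (_< _) ∣p∪q∪r∣≡ (x∉p⇒∣p∣<n (x∉p∪q x∉p (x∉p∪q x∉q x∉r)))
  where
  ∣p∪q∪r∣≡ : ∣ p ∪ q ∪ r ∣ ≡ ∣ p ∣ + (∣ q ∣ + ∣ r ∣)
  ∣p∪q∪r∣≡ = trans (∣p∪q∣≡∣p∣+∣q∣ (disjoint-∪ʳ d₁₂ d₁₃)) (cong (∣ p ∣ +_) (∣p∪q∣≡∣p∣+∣q∣ d₂₃))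

colourClass-spanningPath : (c : Fin 3) → SpanningPath G (colourClass G c)
colourClass-spanningPath = from-yes (all? λ c → spanningPath? G (colourClass G c))

blue34 : Fin 9
blue34 = # 5

blue34∉rainbowSpanningPath : ∀ {P} → SpanningPath G P → Rainbow G P → blue34 ∉ P
blue34∉rainbowSpanningPath {P} spP rbP blue34∈P =
  from-no (anySubset? λ P → (spanningPath? G P ×-dec rainbow? G P) ×-dec (blue34 ∈? P))
    (P , (spP , rbP) , blue34∈P)

proposition4p3 : ((c : Fin 3) → SpanningPath G (colourClass G c))
    × ¬ (Σ (Subset 9) λ P₁ → Σ (Subset 9) λ P₂ → Σ (Subset 9) λ P₃ →
          (SpanningPath G P₁ × Rainbow G P₁) ×
          (SpanningPath G P₂ × Rainbow G P₂) ×
          (SpanningPath G P₃ × Rainbow G P₃) ×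
          Disjoint P₁ P₂ × Disjoint P₁ P₃ × Disjoint P₂ P₃)
proposition4p3 = colourClass-spanningPath ,
  λ { (P₁ , P₂ , P₃ , (sp₁ , rb₁) , (sp₂ , rb₂) , (sp₃ , rb₃) , d₁₂ , d₁₃ , d₂₃) →
      <-irrefl refl
        (subst (_< 9) (cong₂ _+_ (proj₁ sp₁) (cong₂ _+_ (proj₁ sp₂) (proj₁ sp₃)))
          (pairwiseDisjoint-avoiding-∣∣ d₁₂ d₁₃ d₂₃
            (blue34∉rainbowSpanningPath sp₁ rb₁)
            (blue34∉rainbowSpanningPath sp₂ rb₂)
            (blue34∉rainbowSpanningPath sp₃ rb₃))) }
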